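{- Fix $m\geq1$, let $M$ be a rank-$k$ loopless matroid on $E$, and let $Q=Q_m(M)$ (a matroid of rank $k+1$, with closure operator $\mathrm{cl}$ and rank function $r$). Let $(Y_0,Y_1,\dots,Y_{k+1})$ be a flag of $Q$ and fix $j\in[k+1]$. If $a\in Y_{j-1}$, then $Y_{j-1}=q(X_{j-2})$ and $Y_j=q(X_{j-1})$ where $X_{j-2}\subset X_{j-1}$ are flats of $M$ of ranks $j-2$ and $j-1$ respectively. If $a\notin Y_{j-1}$, then $Y_j$ satisfies exactly one of the following: (i) $Y_j=\mathrm{cl}(Y_{j-1}\cup\{a\})=q(\mathrm{cl}(p(Y_{j-1})))$; (ii) $Y_j-E=Y_{j-1}-E$ and $r(Y_j\cap E)=r(Y_{j-1}\cap E)+1$; (iii) $Y_j=Y_{j-1}\cup\{x\}$ where $x\in T$ and $p(x)\notin\mathrm{cl}(p(Y_{j-1}))$. Case (i) occurs when $Y_j$ is the first flat in the flag that contains $a$.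
   Context: A flag of a rank-$d$ matroid is a sequence $(Y_0,\dots,Y_d)$ where $Y_i$ is a rank-$i$ flat and $Y_i\subsetneq Y_{i+1}$. Cyclic set: $X$ with $M|X$ having no coloops; cyclic flat: a flat that is cyclic; $\mathcal{Z}(M)$: the set of cyclic flats. Free $m$-cone: let $M=(E,r)$ be loopless and $m\geq1$. For each $e\in E$ let $T_e$ be a set of $m$ new elements (pairwise disjoint, disjoint from $E$), $T=\bigcup_e T_e$, and $a$ a further new element (the tip); $E(Q)=E\cup T\cup\{a\}$. For $S\subseteq E$ let $q(S)=S\cup\{a\}\cup\bigcup_{e\in S}T_e$, and for $S\subseteq E(Q)$ let $p(S)=(S\cap E)\cup\{e\in E: S\cap T_e\neq\varnothing\}$ (write $p(x)$ for $p(\{x\})$). The free $m$-cone $Q=Q_m(M)$ is the unique matroid on $E(Q)$ whose cyclic flats are exactly the sets in $\mathcal{Z}(M)\cup\{q(F):F\text{ a nonempty flat of }M\}$, with rank $r(Z)$ on $Z\in\mathcal{Z}(M)$ and rank $r(F)+1$ on $q(F)$; on subsets of $E$ its rank agrees with that of $M$, so $r$ denotes both. -}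

module Defs where

open import Data.Nat using (ℕ; zero; suc; _+_; _*_; _≤_; _≟_)
open import Data.Bool using (Bool; true; false; _∨_)
open import Data.Fin using (Fin; zero; suc; splitAt; remQuot; combine; _↑ˡ_; _↑ʳ_)
open import Data.Fin.Subset using (Subset; _∈_; _∉_; _⊆_; _⊂_; _∪_; _∩_; ∁; ⁅_⁆; ∣_∣; ⊤; ⊥)
open import Data.Vec using (tabulate; lookup)
open import Data.Product using (Σ; _×_; _,_; ∃)
open import Data.Sum using (_⊎_; inj₁; inj₂)
open import Relation.Nullary using (¬_; does)
open import Relation.Binary.PropositionalEquality using (_≡_; _≢_)

record Matroid (N : ℕ) : Set where
  field
    rk   : Subset N → ℕ
    rk-card : ∀ X → rk X ≤ ∣ X ∣
    rk-mono : ∀ X Y → X ⊆ Y → rk X ≤ rk Y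
    rk-submod : ∀ X Y → rk (X ∪ Y) + rk (X ∩ Y) ≤ rk X + rk Y

open Matroid public

module _ {N : ℕ} (M : Matroid N) where

  rank : ℕ
  rank = rk M ⊤

  cl : Subset N → Subset N
  cl X = tabulate (λ x → does (rk M (X ∪ ⁅ x ⁆) ≟ rk M X))

  IsFlat : Subset N → Set
  IsFlat X = ∀ x → rk M (X ∪ ⁅ x ⁆) ≡ rk M X → x ∈ X

  Loopless : Set
  Loopless = ∀ e → rk M ⁅ e ⁆ ≡ 1

  IsCyclic : Subset N → Set
  IsCyclic X = ∀ x → x ∈ X → rk M (X ∩ ∁ ⁅ x ⁆) ≡ rk M X

  IsCyclicFlat : Subset N → Set
  IsCyclicFlat X = IsFlat X × IsCyclic X

  -- a flag (Y₀,…,Y_d) of a rank-d matroid, indexed by ℕ (values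
  -- beyond index d are irrelevant)
  IsFlag : (ℕ → Subset N) → Set
  IsFlag Y = (∀ i → i ≤ rank → IsFlat (Y i) × rk M (Y i) ≡ i)
           × (∀ i → suc i ≤ rank → Y i ⊂ Y (suc i))

-- Ground set of the free m-cone over a matroid on Fin n:
-- E(Q) = Fin (suc (n + n * m)), with
--   tip            = zero
--   inE e          = suc (e ↑ˡ (n * m))
--   inT e t        = suc (n ↑ʳ combine e t)     (t-th element of T_e)

coneSize : ℕ → ℕ → ℕ
coneSize n m = suc (n + n * m)

tip : ∀ {n m} → Fin (coneSize n m)
tip = zero

inE : ∀ {n m} → Fin n → Fin (coneSize n m)
inE {n} {m} e = suc (e ↑ˡ (n * m))

inT : ∀ {n m} → Fin n → Fin m → Fin (coneSize n m)
inT {n} {m} e t = suc (n ↑ʳ combine e t)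

data Kind (n m : ℕ) : Set where
  kTip : Kind n m
  kE   : Fin n → Kind n m
  kT   : Fin n → Fin m → Kind n m

decode : ∀ {n m} → Fin (coneSize n m) → Kind n m
decode zero = kTip
decode {n} {m} (suc x) with splitAt n x
... | inj₁ e = kE e
... | inj₂ y with remQuot {n} m y
...   | (e , t) = kT e t

embE : ∀ {n m} → Subset n → Subset (coneSize n m)
embE S = tabulate λ x → f (decode x)
  where
  f : _ → Bool
  f kTip = false
  f (kE e) = lookup S e
  f (kT e t) = false

-- q(S) = S ∪ {a} ∪ ⋃_{e ∈ S} T_e
q : ∀ {n m} → Subset n → Subset (coneSize n m)
q S = tabulate λ x → f (decode x)
  where
  f : _ → Bool
  f kTip = true
  f (kE e) = lookup S e
  f (kT e t) = lookup S e

anyFin : ∀ {m} → (Fin m → Bool) → Bool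
anyFin {zero} f = false
anyFin {suc m} f = f zero ∨ anyFin (λ i → f (suc i))

-- p(S) = (S ∩ E) ∪ { e : S ∩ T_e ≠ ∅ }
p : ∀ {n m} → Subset (coneSize n m) → Subset n
p {n} {m} S = tabulate λ e → lookup S (inE e) ∨ anyFin (λ t → lookup S (inT {n} {m} e t))

Eset : ∀ {n m} → Subset (coneSize n m)
Eset {n} {m} = embE {n} {m} ⊤

-- Q is the free m-cone over M: the matroid on E(Q) whose cyclic flats
-- are exactly Z(M) ∪ { q(F) : F nonempty flat of M }, with r_Q(Z) = r_M(Z)
-- and r_Q(q F) = r_M(F) + 1; moreover r_Q agrees with r_M on subsets of E.

Nonempty : ∀ {n} → Subset n → Set
Nonempty S = ∃ λ e → e ∈ S

record IsFreeCone {n : ℕ} (m : ℕ) (M : Matroid n) (Q : Matroid (coneSize n m)) : Set where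
  field
    cyclicFlats : ∀ Z → IsCyclicFlat Q Z →
      (Σ (Subset n) λ Z′ → IsCyclicFlat M Z′ × Z ≡ embE Z′)
      ⊎ (Σ (Subset n) λ F → IsFlat M F × Nonempty F × Z ≡ q F)
    cyclicFlats-E : ∀ Z → IsCyclicFlat M Z → IsCyclicFlat Q (embE Z)
    cyclicFlats-q : ∀ F → IsFlat M F → Nonempty F → IsCyclicFlat Q (q F)
    rank-E : ∀ Z → IsCyclicFlat M Z → rk Q (embE Z) ≡ rk M Z
    rank-q : ∀ F → IsFlat M F → Nonempty F → rk Q (q F) ≡ suc (rk M F)
    rank-agree : ∀ S → rk Q (embE S) ≡ rk M S

ExactlyOne : Set → Set → Set → Set
ExactlyOne A B C = (A ⊎ B ⊎ C) × ¬ (A × B) × ¬ (A × C) × ¬ (B × C)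

-- A non-E element z that is not a coloop of a set W lies in a cyclic flat of Q inside cl W (take the
-- closure of the non-coloops of W); by the description of the cyclic flats of Q this flat is some
-- q F, so the tip a is spanned by W. Hence a together with any other point of q (cl ⁅ e ⁆) spans this
-- rank-2 line, and every flat of Q containing a is q F for a flat F of M.
-- Let Y′ ⋖ Y be consecutive flats of the flag. If a ∈ Y′, both are such q-images. If a ∈ Y ∖ Y′, then
-- Y = cl (Y′ ∪ ⁅ a ⁆) = q (cl (p Y′)). If a ∉ Y, no non-E element is a non-coloop of a subset of Y.
-- So a new element of T makes Y′ ∪ ⁅ x ⁆ a flat, and exchange with a shows p x ∉ cl (p Y′); if all
-- new elements lie in E, deleting the non-E elements of subsets of Y preserves spans, so Y ∩ E has
-- rank exactly one more than Y′ ∩ E.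

module Submission where

open import Defs
open import Data.Bool using (Bool; true; false; _∨_)
open import Data.Bool.Properties using (∨-zeroʳ)
open import Data.Fin using (Fin; splitAt; combine; remQuot; _↑ˡ_; _↑ʳ_)
open import Data.Fin.Properties
  using (any?; splitAt-↑ˡ; splitAt-↑ʳ; splitAt⁻¹-↑ˡ; splitAt⁻¹-↑ʳ; remQuot-combine; combine-remQuot)
import Data.Fin as Fin
open import Data.Fin.Subset
  using (Subset; _∈_; _∉_; _⊆_; _⊂_; _∪_; _∩_; ∁; ⁅_⁆; ∣_∣; ⊥; ⊤)
open import Data.Fin.Subset.Properties
open import Data.Nat using (ℕ; zero; suc; _+_; _*_; _∸_; _≤_; _<_; z≤n; s≤s; _≟_; _<?_)
open import Data.Nat.Properties
open import Data.Product using (Σ; ∃; _×_; _,_; proj₁; proj₂)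
open import Data.Sum using (_⊎_; inj₁; inj₂; [_,_]′)
open import Function using (_∘_; _∋_)
open import Data.Vec using (lookup; tabulate; here)
open import Data.Vec.Properties using (lookup∘tabulate; []=⇒lookup; lookup⇒[]=)
open import Relation.Nullary using (¬_; yes; no; does; contradiction)
open import Relation.Nullary.Decidable using (dec-true; decidable-stable; _×-dec_; ¬?)
open import Level using (Level)
open import Relation.Unary using (Pred; Decidable)
open import Relation.Binary.PropositionalEquality
  using (_≡_; _≢_; refl; sym; trans; cong; cong₂; subst; subst₂)

private variable
  N : ℕ
  x y u : Fin N
  A B C W : Subset N

∪⁺ˡ : x ∈ A → x ∈ A ∪ B
∪⁺ˡ h = x∈p∪q⁺ (inj₁ h)

∪⁺ʳ : x ∈ B → x ∈ A ∪ B
∪⁺ʳ h = x∈p∪q⁺ (inj₂ h)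

∪⁻ : x ∈ A ∪ B → x ∈ A ⊎ x ∈ B
∪⁻ {A = A} {B} = x∈p∪q⁻ A B

∪-least : A ⊆ C → B ⊆ C → A ∪ B ⊆ C
∪-least A⊆C B⊆C h = [ A⊆C , B⊆C ]′ (∪⁻ h)

∩⁺ : x ∈ A → x ∈ B → x ∈ A ∩ B
∩⁺ a b = x∈p∩q⁺ (a , b)

∩⁻ˡ : x ∈ A ∩ B → x ∈ A
∩⁻ˡ {A = A} {B} h = proj₁ (x∈p∩q⁻ A B h)

∩⁻ʳ : x ∈ A ∩ B → x ∈ B
∩⁻ʳ {A = A} {B} h = proj₂ (x∈p∩q⁻ A B h)

⁅x⁆⊆ : x ∈ A → ⁅ x ⁆ ⊆ A
⁅x⁆⊆ {A = A} x∈A y∈⁅x⁆ = subst (_∈ A) (sym (x∈⁅y⁆⇒x≡y _ y∈⁅x⁆)) x∈A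

-- Not Data.Fin.Subset._-_ (defined through _─_): this form matches Defs.IsCyclic definitionally.
_∖_ : Subset N → Fin N → Subset N
W ∖ u = W ∩ ∁ ⁅ u ⁆

∖⁺ : x ∈ W → x ≢ u → x ∈ W ∖ u
∖⁺ x∈W x≢u = ∩⁺ x∈W (x∉p⇒x∈∁p (x≢y⇒x∉⁅y⁆ x≢u))

∖⁻ˡ : x ∈ W ∖ u → x ∈ W
∖⁻ˡ = ∩⁻ˡ

∖⁻ʳ : x ∈ W ∖ u → x ≢ u
∖⁻ʳ h = x∉⁅y⁆⇒x≢y (x∈∁p⇒x∉p (∩⁻ʳ h))

∩∁-∪⁅⁆ : W ∩ ∁ (A ∪ ⁅ x ⁆) ≡ (W ∩ ∁ A) ∖ x
∩∁-∪⁅⁆ {W = W} {A} {x} = ⊆-antisym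
  (λ h → let y∉A∪x = x∈∁p⇒x∉p (∩⁻ʳ h) in
    ∖⁺ (∩⁺ (∩⁻ˡ h) (x∉p⇒x∈∁p (y∉A∪x ∘ ∪⁺ˡ))) λ { refl → y∉A∪x (∪⁺ʳ (x∈⁅x⁆ x)) })
  (λ h → ∩⁺ (∩⁻ˡ (∖⁻ˡ {W = W ∩ ∁ A} h)) (x∉p⇒x∈∁p ([ x∈∁p⇒x∉p (∩⁻ʳ (∖⁻ˡ {W = W ∩ ∁ A} h))
                                                   , ∖⁻ʳ {W = W ∩ ∁ A} h ∘ x∈⁅y⁆⇒x≡y x ]′ ∘ ∪⁻)))

∩∁-∩∁ : W ∩ ∁ (W ∩ ∁ A) ≡ W ∩ A
∩∁-∩∁ = ⊆-antisym
  (λ h → ∩⁺ (∩⁻ˡ h) (x∉∁p⇒x∈p λ x∈∁A → x∈∁p⇒x∉p (∩⁻ʳ h) (∩⁺ (∩⁻ˡ h) x∈∁A)))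
  (λ h → ∩⁺ (∩⁻ˡ h) (x∉p⇒x∈∁p λ x∈W∩∁A → x∈p⇒x∉∁p (∩⁻ʳ h) (∩⁻ʳ x∈W∩∁A)))

∈-tabulate-does⁺ : {p : Level} {P : Pred (Fin N) p} (P? : Decidable P) → P x → x ∈ tabulate (λ y → does (P? y))
∈-tabulate-does⁺ {x = x} P? px =
  lookup⇒[]= x _ (trans (lookup∘tabulate _ x) (dec-true (P? x) px))

∈-tabulate-does⁻ : {p : Level} {P : Pred (Fin N) p} (P? : Decidable P) → x ∈ tabulate (λ y → does (P? y)) → P x
∈-tabulate-does⁻ {x = x} P? h with P? x | trans (sym (lookup∘tabulate _ x)) ([]=⇒lookup h)
... | yes px | _ = px

∣B∖x∣<∣B∣ : x ∈ B → ∣ B ∖ x ∣ < ∣ B ∣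
∣B∖x∣<∣B∣ {x = x} {B = B} x∈B =
  p⊂q⇒∣p∣<∣q∣ (∖⁻ˡ {W = B} {u = x} , x , x∈B , λ x∈B∖x → ∖⁻ʳ {W = B} x∈B∖x refl)

B∖x∪⁅x⁆≡B : x ∈ B → (B ∖ x) ∪ ⁅ x ⁆ ≡ B
B∖x∪⁅x⁆≡B {x = x} {B = B} x∈B = ⊆-antisym (∪-least ∖⁻ˡ (⁅x⁆⊆ x∈B)) B⊆
  where
  B⊆ : B ⊆ (B ∖ x) ∪ ⁅ x ⁆
  B⊆ {y} y∈B with y Fin.≟ x
  ... | yes refl = ∪⁺ʳ (x∈⁅x⁆ x)
  ... | no y≢x = ∪⁺ˡ (∖⁺ y∈B y≢x)

subset-induction : (P : Subset N → Set) → P ⊥ → (∀ A u → u ∉ A → P A → P (A ∪ ⁅ u ⁆)) → ∀ B → P B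
subset-induction {N} P P⊥ P∪ B = go ∣ B ∣ B ≤-refl
  where
  go : ∀ k B → ∣ B ∣ ≤ k → P B
  go k B ∣B∣≤k with nonempty? B
  ... | no empty = subst P (sym (Empty-unique empty)) P⊥
  go zero B ∣B∣≤0 | yes (x , x∈B) = contradiction (≤-trans (∣B∖x∣<∣B∣ x∈B) ∣B∣≤0) λ ()
  go (suc k) B ∣B∣≤1+k | yes (x , x∈B) =
    subst P (B∖x∪⁅x⁆≡B x∈B) (P∪ (B ∖ x) x (λ x∈B∖x → ∖⁻ʳ x∈B∖x refl)
      (go k (B ∖ x) (≤-pred (≤-trans (∣B∖x∣<∣B∣ x∈B) ∣B∣≤1+k))))

-- Rank, closure, flats and coloops

module MatroidProperties (M : Matroid N) where
  open ≤-Reasoning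

  r : Subset N → ℕ
  r = rk M

  r-mono : A ⊆ B → r A ≤ r B
  r-mono {A} {B} = rk-mono M A B

  r-submod⊆ : ∀ A B {U I} → U ⊆ A ∪ B → I ⊆ A ∩ B → r U + r I ≤ r A + r B
  r-submod⊆ A B U⊆ I⊆ = ≤-trans (+-mono-≤ (r-mono U⊆) (r-mono I⊆)) (rk-submod M A B)

  r-⁅⁆≤1 : ∀ x → r ⁅ x ⁆ ≤ 1
  r-⁅⁆≤1 x = subst (r ⁅ x ⁆ ≤_) (∣⁅x⁆∣≡1 x) (rk-card M ⁅ x ⁆)

  r-⊥ : r ⊥ ≡ 0
  r-⊥ = n≤0⇒n≡0 (subst (r ⊥ ≤_) (∣⊥∣≡0 N) (rk-card M ⊥))

  r-∪⁅⁆ : ∀ A x → r (A ∪ ⁅ x ⁆) ≤ suc (r A)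
  r-∪⁅⁆ A x = begin
    r (A ∪ ⁅ x ⁆)                 ≤⟨ m≤m+n _ _ ⟩
    r (A ∪ ⁅ x ⁆) + r (A ∩ ⁅ x ⁆) ≤⟨ rk-submod M A ⁅ x ⁆ ⟩
    r A + r ⁅ x ⁆                 ≤⟨ +-monoʳ-≤ (r A) (r-⁅⁆≤1 x) ⟩
    r A + 1                       ≡⟨ +-comm (r A) 1 ⟩
    suc (r A)                     ∎

  ∈cl⁺ : r (A ∪ ⁅ x ⁆) ≡ r A → x ∈ cl M A
  ∈cl⁺ {A} = ∈-tabulate-does⁺ (λ x → r (A ∪ ⁅ x ⁆) ≟ r A)

  ∈cl⁻ : x ∈ cl M A → r (A ∪ ⁅ x ⁆) ≡ r A
  ∈cl⁻ {A = A} = ∈-tabulate-does⁻ (λ x → r (A ∪ ⁅ x ⁆) ≟ r A)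

  ⊆-cl : A ⊆ cl M A
  ⊆-cl x∈A = ∈cl⁺ (cong r (⊆-antisym (∪-least (λ h → h) (⁅x⁆⊆ x∈A)) ∪⁺ˡ))

  cl-mono : A ⊆ B → cl M A ⊆ cl M B
  cl-mono {A} {B} A⊆B {x} x∈clA = ∈cl⁺ (≤-antisym (+-cancelʳ-≤ (r A) _ _ (begin
    r (B ∪ ⁅ x ⁆) + r A ≤⟨ r-submod⊆ (A ∪ ⁅ x ⁆) B (∪-least ∪⁺ʳ (∪⁺ˡ ∘ ∪⁺ʳ)) (λ h → ∩⁺ (∪⁺ˡ h) (A⊆B h)) ⟩
    r (A ∪ ⁅ x ⁆) + r B ≡⟨ cong (_+ r B) (∈cl⁻ x∈clA) ⟩
    r A + r B           ≡⟨ +-comm (r A) (r B) ⟩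
    r B + r A           ∎)) (r-mono ∪⁺ˡ))

  r-∪-⊆cl : ∀ A B → B ⊆ cl M A → r (A ∪ B) ≡ r A
  r-∪-⊆cl A = subset-induction (λ B → B ⊆ cl M A → r (A ∪ B) ≡ r A)
    (λ _ → cong r (⊆-antisym (∪-least (λ h → h) (λ h → contradiction h ∉⊥)) ∪⁺ˡ))
    step
    where
    step : ∀ B u → u ∉ B → (B ⊆ cl M A → r (A ∪ B) ≡ r A) →
           B ∪ ⁅ u ⁆ ⊆ cl M A → r (A ∪ (B ∪ ⁅ u ⁆)) ≡ r A
    step B u _ ih B∪u⊆ = ≤-antisym (+-cancelʳ-≤ (r A) _ _ (begin
      r (A ∪ (B ∪ ⁅ u ⁆)) + r A
        ≤⟨ r-submod⊆ (A ∪ B) (A ∪ ⁅ u ⁆)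
             (∪-least (∪⁺ˡ ∘ ∪⁺ˡ) (∪-least (∪⁺ˡ ∘ ∪⁺ʳ) (∪⁺ʳ ∘ ∪⁺ʳ))) (λ h → ∩⁺ (∪⁺ˡ h) (∪⁺ˡ h)) ⟩
      r (A ∪ B) + r (A ∪ ⁅ u ⁆)
        ≡⟨ cong₂ _+_ (ih (B∪u⊆ ∘ ∪⁺ˡ)) (∈cl⁻ (B∪u⊆ (∪⁺ʳ (x∈⁅x⁆ u)))) ⟩
      r A + r A ∎)) (r-mono ∪⁺ˡ)

  r-cl : ∀ A → r (cl M A) ≡ r A
  r-cl A = ≤-antisym (≤-trans (r-mono ∪⁺ʳ) (≤-reflexive (r-∪-⊆cl A (cl M A) (λ h → h)))) (r-mono ⊆-cl)

  cl-flat : ∀ A → IsFlat M (cl M A)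
  cl-flat A x r[clA∪x]≡r[clA] = ∈cl⁺ (≤-antisym (begin
    r (A ∪ ⁅ x ⁆)      ≤⟨ r-mono (∪-least (∪⁺ˡ ∘ ⊆-cl) ∪⁺ʳ) ⟩
    r (cl M A ∪ ⁅ x ⁆) ≡⟨ r[clA∪x]≡r[clA] ⟩
    r (cl M A)         ≡⟨ r-cl A ⟩
    r A                ∎) (r-mono ∪⁺ˡ))

  cl⊆flat : ∀ {F} → IsFlat M F → A ⊆ F → cl M A ⊆ F
  cl⊆flat flatF A⊆F x∈clA = flatF _ (∈cl⁻ (cl-mono A⊆F x∈clA))

  r-flat-∪⁅⁆ : ∀ {F} → IsFlat M F → x ∉ F → r (F ∪ ⁅ x ⁆) ≡ suc (r F)
  r-flat-∪⁅⁆ flatF x∉F = ≤-antisym (r-∪⁅⁆ _ _) (≤∧≢⇒< (r-mono ∪⁺ˡ) (λ eq → x∉F (flatF _ (sym eq))))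

  flat-⊇⇒⊆ : ∀ {F} → IsFlat M F → F ⊆ B → r B ≤ r F → B ⊆ F
  flat-⊇⇒⊆ flatF F⊆B rB≤rF x∈B =
    flatF _ (≤-antisym (≤-trans (r-mono (∪-least F⊆B (⁅x⁆⊆ x∈B))) rB≤rF) (r-mono ∪⁺ˡ))

  IsColoop : Subset N → Fin N → Set
  IsColoop W u = r (W ∖ u) < r W

  coloop⇒∈ : IsColoop W u → u ∈ W
  coloop⇒∈ {W} {u} coloop with u ∈? W
  ... | yes u∈W = u∈W
  ... | no u∉W = contradiction (r-mono (λ x∈W → ∖⁺ x∈W λ { refl → u∉W x∈W })) (<⇒≱ coloop)

  coloop-restrict : ∀ {V} → IsColoop W u → u ∈ V → V ⊆ W → IsColoop V u
  coloop-restrict {W} {u} {V} coloop u∈V V⊆W = +-cancelˡ-< (r (W ∖ u)) _ _ (begin-strict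
    r (W ∖ u) + r (V ∖ u) <⟨ +-monoˡ-< (r (V ∖ u)) coloop ⟩
    r W + r (V ∖ u)       ≤⟨ r-submod⊆ (W ∖ u) V W⊆ (λ h → ∩⁺ (∖⁺ (V⊆W (∖⁻ˡ h)) (∖⁻ʳ h)) (∖⁻ˡ h)) ⟩
    r (W ∖ u) + r V       ∎)
    where
    W⊆ : W ⊆ (W ∖ u) ∪ V
    W⊆ {x} x∈W with x Fin.≟ u
    ... | yes refl = ∪⁺ʳ u∈V
    ... | no x≢u = ∪⁺ˡ (∖⁺ x∈W x≢u)

  nonColoop-∖coloop : ∀ {k} → IsColoop W k → u ≢ k → r (W ∖ u) ≡ r W → r ((W ∖ k) ∖ u) ≡ r (W ∖ k)
  nonColoop-∖coloop {W} {u} {k} coloop u≢k r[W∖u]≡r[W] = ≤-antisym (r-mono (∖⁻ˡ {W = W ∖ k})) (≤-pred (begin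
    suc (r (W ∖ k))             ≤⟨ coloop ⟩
    r W                         ≡⟨ r[W∖u]≡r[W] ⟨
    r (W ∖ u)                   ≤⟨ r-mono W∖u⊆ ⟩
    r (((W ∖ k) ∖ u) ∪ ⁅ k ⁆)   ≤⟨ r-∪⁅⁆ _ k ⟩
    suc (r ((W ∖ k) ∖ u))       ∎))
    where
    W∖u⊆ : W ∖ u ⊆ ((W ∖ k) ∖ u) ∪ ⁅ k ⁆
    W∖u⊆ {x} h with x Fin.≟ k
    ... | yes refl = ∪⁺ʳ (x∈⁅x⁆ x)
    ... | no x≢k = ∪⁺ˡ (∖⁺ (∖⁺ (∖⁻ˡ h) x≢k) (∖⁻ʳ h))

  nonColoop-∖coloops : ∀ A → (∀ {k} → k ∈ A → IsColoop W k) → u ∉ A →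
                       r (W ∖ u) ≡ r W → r ((W ∩ ∁ A) ∖ u) ≡ r (W ∩ ∁ A)
  nonColoop-∖coloops {W} {u} A A-coloops u∉A r[W∖u]≡r[W] = subset-induction P base step A A-coloops u∉A
    where
    P : Subset N → Set
    P A = (∀ {k} → k ∈ A → IsColoop W k) → u ∉ A → r ((W ∩ ∁ A) ∖ u) ≡ r (W ∩ ∁ A)
    W∩∁⊥≡W : W ∩ ∁ ⊥ ≡ W
    W∩∁⊥≡W = ⊆-antisym ∩⁻ˡ (λ h → ∩⁺ h (x∉p⇒x∈∁p ∉⊥))
    base : P ⊥
    base _ _ rewrite W∩∁⊥≡W = r[W∖u]≡r[W]
    step : ∀ A k → k ∉ A → P A → P (A ∪ ⁅ k ⁆)
    step A k k∉A ih A∪k-coloops u∉A∪k rewrite ∩∁-∪⁅⁆ {W = W} {A} {k} =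
      nonColoop-∖coloop
        (coloop-restrict k-coloop (∩⁺ (coloop⇒∈ k-coloop) (x∉p⇒x∈∁p k∉A)) ∩⁻ˡ)
        (λ { refl → u∉A∪k (∪⁺ʳ (x∈⁅x⁆ u)) })
        (ih (A∪k-coloops ∘ ∪⁺ˡ) (u∉A∪k ∘ ∪⁺ˡ))
      where
      k-coloop : IsColoop W k
      k-coloop = A∪k-coloops (∪⁺ʳ (x∈⁅x⁆ k))

  coloops : Subset N → Subset N
  coloops W = tabulate (λ u → does (r (W ∖ u) <? r W))

  nonColoops-cyclic : ∀ W → IsCyclic M (W ∩ ∁ (coloops W))
  nonColoops-cyclic W u u∈nonColoops =
    nonColoop-∖coloops (coloops W) (∈-tabulate-does⁻ (λ u → r (W ∖ u) <? r W)) u∉coloops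
      (≤-antisym (r-mono ∖⁻ˡ) (≮⇒≥ (u∉coloops ∘ ∈-tabulate-does⁺ (λ u → r (W ∖ u) <? r W))))
    where
    u∉coloops = x∈∁p⇒x∉p (∩⁻ʳ u∈nonColoops)

  cl-cyclic : IsCyclic M C → IsCyclic M (cl M C)
  cl-cyclic {C} cyclicC u _ with u ∈? C
  ... | yes u∈C = ≤-antisym (r-mono ∖⁻ˡ) (begin
    r (cl M C)       ≡⟨ r-cl C ⟩
    r C              ≡⟨ cyclicC u u∈C ⟨
    r (C ∖ u)        ≤⟨ r-mono (λ h → ∖⁺ (⊆-cl (∖⁻ˡ h)) (∖⁻ʳ h)) ⟩
    r (cl M C ∖ u)   ∎)
  ... | no u∉C = ≤-antisym (r-mono ∖⁻ˡ) (begin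
    r (cl M C)       ≡⟨ r-cl C ⟩
    r C              ≤⟨ r-mono (λ x∈C → ∖⁺ (⊆-cl x∈C) λ { refl → u∉C x∈C }) ⟩
    r (cl M C ∖ u)   ∎)

  cyclicFlat-∋-nonColoop : u ∈ W → r (W ∖ u) ≡ r W →
                           Σ (Subset N) λ Z → IsCyclicFlat M Z × u ∈ Z × Z ⊆ cl M W
  cyclicFlat-∋-nonColoop {u} {W} u∈W r[W∖u]≡r[W] =
    cl M (W ∩ ∁ (coloops W)) ,
    (cl-flat _ , cl-cyclic (nonColoops-cyclic W)) ,
    ⊆-cl (∩⁺ u∈W (x∉p⇒x∈∁p (<-irrefl r[W∖u]≡r[W] ∘ ∈-tabulate-does⁻ (λ u → r (W ∖ u) <? r W)))) ,
    cl-mono ∩⁻ˡ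

  nonColoop⇒∈cl : u ∈ W → r (W ∖ u) ≡ r W → u ∈ cl M (W ∖ u)
  nonColoop⇒∈cl {u} {W} u∈W r[W∖u]≡r[W] = ∈cl⁺ (trans (cong r (B∖x∪⁅x⁆≡B u∈W)) (sym r[W∖u]≡r[W]))

  exchange : ∀ {F} → IsFlat M F → x ∉ F → y ∉ F → x ∈ cl M (F ∪ ⁅ y ⁆) → y ∈ cl M (F ∪ ⁅ x ⁆)
  exchange {x = x} {y = y} {F = F} flatF x∉F y∉F x∈cl = ∈cl⁺ (≤-antisym (begin
    r ((F ∪ ⁅ x ⁆) ∪ ⁅ y ⁆) ≤⟨ r-mono (∪-least (∪-least (⊆-cl ∘ ∪⁺ˡ) (⁅x⁆⊆ x∈cl)) (⊆-cl ∘ ∪⁺ʳ)) ⟩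
    r (cl M (F ∪ ⁅ y ⁆))    ≡⟨ r-cl _ ⟩
    r (F ∪ ⁅ y ⁆)           ≡⟨ r-flat-∪⁅⁆ flatF y∉F ⟩
    suc (r F)               ≡⟨ r-flat-∪⁅⁆ flatF x∉F ⟨
    r (F ∪ ⁅ x ⁆)           ∎) (r-mono ∪⁺ˡ))

  module Covering {F G} (flatF : IsFlat M F) (flatG : IsFlat M G) (F⊆G : F ⊆ G)
                  (rG≡1+rF : r G ≡ suc (r F)) where

    r-F∪⁅x⁆ : x ∉ F → r (F ∪ ⁅ x ⁆) ≡ r G
    r-F∪⁅x⁆ x∉F = trans (r-flat-∪⁅⁆ flatF x∉F) (sym rG≡1+rF)

    ≡cl-F∪⁅x⁆ : x ∈ G → x ∉ F → G ≡ cl M (F ∪ ⁅ x ⁆)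
    ≡cl-F∪⁅x⁆ x∈G x∉F = ⊆-antisym
      (flat-⊇⇒⊆ (cl-flat _) cl⊆G (≤-reflexive (sym (trans (r-cl _) (r-F∪⁅x⁆ x∉F)))))
      cl⊆G
      where
      cl⊆G = cl⊆flat flatG (∪-least F⊆G (⁅x⁆⊆ x∈G))

    nonColoop : x ∈ G → y ∈ G → x ∉ F → y ∉ F → x ≢ y →
                r (((F ∪ ⁅ y ⁆) ∪ ⁅ x ⁆) ∖ x) ≡ r ((F ∪ ⁅ y ⁆) ∪ ⁅ x ⁆)
    nonColoop {x} {y} x∈G y∈G x∉F y∉F x≢y = ≤-antisym (r-mono ∖⁻ˡ) (begin
      r ((F ∪ ⁅ y ⁆) ∪ ⁅ x ⁆)       ≤⟨ r-mono (∪-least (∪-least F⊆G (⁅x⁆⊆ y∈G)) (⁅x⁆⊆ x∈G)) ⟩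
      r G                           ≡⟨ r-F∪⁅x⁆ y∉F ⟨
      r (F ∪ ⁅ y ⁆)                 ≤⟨ r-mono (∪-least F⊆W∖x ⁅y⁆⊆W∖x) ⟩
      r (((F ∪ ⁅ y ⁆) ∪ ⁅ x ⁆) ∖ x) ∎)
      where
      F⊆W∖x : F ⊆ ((F ∪ ⁅ y ⁆) ∪ ⁅ x ⁆) ∖ x
      F⊆W∖x z∈F = ∖⁺ (∪⁺ˡ (∪⁺ˡ z∈F)) λ { refl → x∉F z∈F }
      ⁅y⁆⊆W∖x : ⁅ y ⁆ ⊆ ((F ∪ ⁅ y ⁆) ∪ ⁅ x ⁆) ∖ x
      ⁅y⁆⊆W∖x z∈⁅y⁆ with refl ← x∈⁅y⁆⇒x≡y y z∈⁅y⁆ = ∖⁺ (∪⁺ˡ (∪⁺ʳ (x∈⁅x⁆ y))) (x≢y ∘ sym)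

-- The ground set of the free cone

anyFin⁻ : ∀ {k} (f : Fin k → Bool) → anyFin f ≡ true → ∃ λ i → f i ≡ true
anyFin⁻ {suc k} f h with f Fin.zero in f0
... | true = Fin.zero , f0
... | false = let (i , fi) = anyFin⁻ (f ∘ Fin.suc) h in Fin.suc i , fi

anyFin⁺ : ∀ {k} (f : Fin k → Bool) i → f i ≡ true → anyFin f ≡ true
anyFin⁺ f Fin.zero fi rewrite fi = refl
anyFin⁺ f (Fin.suc i) fi with f Fin.zero
... | true = refl
... | false = anyFin⁺ (f ∘ Fin.suc) i fi

module ConeGround (n m : ℕ) where

  a : Fin (coneSize n m)
  a = tip {n} {m}

  E : Subset (coneSize n m)
  E = Eset {n} {m}

  data View : Fin (coneSize n m) → Set where
    is-tip : View a
    is-inE : ∀ e → View (inE {n} {m} e)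
    is-inT : ∀ e t → View (inT {n} {m} e t)

  view : ∀ x → View x
  view Fin.zero = is-tip
  view (Fin.suc x) with splitAt n x in eq
  ... | inj₁ e = subst (View ∘ Fin.suc) (splitAt⁻¹-↑ˡ eq) (is-inE e)
  ... | inj₂ y = subst (View ∘ Fin.suc)
                   (trans (cong (n ↑ʳ_) (combine-remQuot {n} m y)) (splitAt⁻¹-↑ʳ eq))
                   (is-inT (proj₁ (remQuot {n} m y)) (proj₂ (remQuot {n} m y)))

  module _ {S : Subset n} {e : Fin n} where

    -- Defs.q and Defs.embE tabulate an unnamed function of Defs.decode; it is exposed by
    -- rewriting with lookup∘tabulate at the tail position, where tabulate no longer unfolds.
    lookup-q-inE : lookup (q {n} {m} S) (inE e) ≡ lookup S e
    lookup-q-inE rewrite (lookup (q {n} {m} S) (inE e) ≡ _ ∋ lookup∘tabulate _ (e ↑ˡ (n * m)))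
                       | splitAt-↑ˡ n e (n * m) = refl

    lookup-q-inT : ∀ t → lookup (q {n} {m} S) (inT e t) ≡ lookup S e
    lookup-q-inT t rewrite (lookup (q {n} {m} S) (inT e t) ≡ _ ∋ lookup∘tabulate _ (n ↑ʳ combine e t))
                         | splitAt-↑ʳ n (n * m) (combine e t) = cong (lookup S ∘ proj₁) (remQuot-combine e t)

    lookup-embE-inE : lookup (embE {n} {m} S) (inE e) ≡ lookup S e
    lookup-embE-inE rewrite (lookup (embE {n} {m} S) (inE e) ≡ _ ∋ lookup∘tabulate _ (e ↑ˡ (n * m)))
                          | splitAt-↑ˡ n e (n * m) = refl

    lookup-embE-inT : ∀ t → lookup (embE {n} {m} S) (inT e t) ≡ false
    lookup-embE-inT t rewrite (lookup (embE {n} {m} S) (inT e t) ≡ _ ∋ lookup∘tabulate _ (n ↑ʳ combine e t))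
                            | splitAt-↑ʳ n (n * m) (combine e t) = refl

    inE∈q⁺ : e ∈ S → inE {n} {m} e ∈ q {n} {m} S
    inE∈q⁺ e∈S = lookup⇒[]= _ _ (trans lookup-q-inE ([]=⇒lookup e∈S))

    inE∈q⁻ : inE {n} {m} e ∈ q {n} {m} S → e ∈ S
    inE∈q⁻ h = lookup⇒[]= _ _ (trans (sym lookup-q-inE) ([]=⇒lookup h))

    inT∈q⁺ : ∀ {t} → e ∈ S → inT {n} {m} e t ∈ q {n} {m} S
    inT∈q⁺ {t} e∈S = lookup⇒[]= _ _ (trans (lookup-q-inT t) ([]=⇒lookup e∈S))

    inT∈q⁻ : ∀ {t} → inT {n} {m} e t ∈ q {n} {m} S → e ∈ S
    inT∈q⁻ {t} h = lookup⇒[]= _ _ (trans (sym (lookup-q-inT t)) ([]=⇒lookup h))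

    inE∈embE⁺ : e ∈ S → inE {n} {m} e ∈ embE {n} {m} S
    inE∈embE⁺ e∈S = lookup⇒[]= _ _ (trans lookup-embE-inE ([]=⇒lookup e∈S))

    inE∈embE⁻ : inE {n} {m} e ∈ embE {n} {m} S → e ∈ S
    inE∈embE⁻ h = lookup⇒[]= _ _ (trans (sym lookup-embE-inE) ([]=⇒lookup h))

    inT∉embE : ∀ {t} → inT {n} {m} e t ∉ embE {n} {m} S
    inT∉embE {t} h with () ← trans (sym ([]=⇒lookup h)) (lookup-embE-inT t)

  a∈q : ∀ {S} → a ∈ q {n} {m} S
  a∈q = here

  a∉embE : ∀ {S} → a ∉ embE {n} {m} S
  a∉embE ()

  embE⊆E : ∀ {S} → embE {n} {m} S ⊆ E
  embE⊆E {x = x} h with view x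
  ... | is-tip = contradiction h a∉embE
  ... | is-inE e = inE∈embE⁺ ∈⊤
  ... | is-inT e t = contradiction h inT∉embE

  q-⊤ : q {n} {m} ⊤ ≡ ⊤
  q-⊤ = ⊆-antisym (λ _ → ∈⊤) λ {x} _ → q∋ x
    where
    q∋ : ∀ x → x ∈ q {n} {m} ⊤
    q∋ x with view x
    ... | is-tip = a∈q
    ... | is-inE e = inE∈q⁺ ∈⊤
    ... | is-inT e t = inT∈q⁺ ∈⊤

  module _ {S : Subset (coneSize n m)} {e : Fin n} where

    ∈p⁻ : e ∈ p S → inE e ∈ S ⊎ ∃ λ t → inT e t ∈ S
    ∈p⁻ h with lookup S (inE e) in inE∈? | trans (sym (lookup∘tabulate _ e)) ([]=⇒lookup h)
    ... | true | _ = inj₁ (lookup⇒[]= _ _ inE∈?)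
    ... | false | any≡true = let (t , inT∈) = anyFin⁻ _ any≡true in inj₂ (t , lookup⇒[]= _ _ inT∈)

    inE∈⇒∈p : inE e ∈ S → e ∈ p S
    inE∈⇒∈p h = lookup⇒[]= _ _ (trans (lookup∘tabulate _ e)
      (cong (_∨ anyFin (λ t → lookup S (inT e t))) ([]=⇒lookup h)))

    inT∈⇒∈p : ∀ {t} → inT e t ∈ S → e ∈ p S
    inT∈⇒∈p {t} h = lookup⇒[]= _ _ (trans (lookup∘tabulate _ e)
      (trans (cong (lookup S (inE e) ∨_) (anyFin⁺ _ t ([]=⇒lookup h))) (∨-zeroʳ _)))

  q-mono : ∀ {S T} → S ⊆ T → q {n} {m} S ⊆ q T
  q-mono {S} {T} S⊆T {x} h with view x
  ... | is-tip = a∈q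
  ... | is-inE e = inE∈q⁺ (S⊆T (inE∈q⁻ h))
  ... | is-inT e t = inT∈q⁺ (S⊆T (inT∈q⁻ h))

  q-⊆⁻ : ∀ {S T} → q {n} {m} S ⊆ q T → S ⊆ T
  q-⊆⁻ qS⊆qT e∈S = inE∈q⁻ (qS⊆qT (inE∈q⁺ e∈S))

  q-⊂⁻ : ∀ {S T} → q {n} {m} S ⊂ q T → S ⊂ T
  q-⊂⁻ (qS⊆qT , x , x∈qT , x∉qS) with view x
  ... | is-tip = contradiction a∈q x∉qS
  ... | is-inE e = q-⊆⁻ qS⊆qT , e , inE∈q⁻ x∈qT , x∉qS ∘ inE∈q⁺
  ... | is-inT e t = q-⊆⁻ qS⊆qT , e , inT∈q⁻ x∈qT , x∉qS ∘ inT∈q⁺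

  ⊆q-p : ∀ A → A ⊆ q {n} {m} (p A)
  ⊆q-p A {x} h with view x
  ... | is-tip = a∈q
  ... | is-inE e = inE∈q⁺ (inE∈⇒∈p h)
  ... | is-inT e t = inT∈q⁺ (inT∈⇒∈p h)

  p-⊆ : ∀ {A S} → A ⊆ q {n} {m} S → p A ⊆ S
  p-⊆ A⊆qS e∈pA with ∈p⁻ e∈pA
  ... | inj₁ inE∈A = inE∈q⁻ (A⊆qS inE∈A)
  ... | inj₂ (t , inT∈A) = inT∈q⁻ (A⊆qS inT∈A)

  embE-∪⁅⁆ : ∀ S e → embE {n} {m} (S ∪ ⁅ e ⁆) ≡ embE S ∪ ⁅ inE e ⁆
  embE-∪⁅⁆ S e = ⊆-antisym ⊆-split (∪-least (embE-mono ∪⁺ˡ) (⁅x⁆⊆ (inE∈embE⁺ (∪⁺ʳ (x∈⁅x⁆ e)))))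
    where
    embE-mono : ∀ {S T} → S ⊆ T → embE {n} {m} S ⊆ embE T
    embE-mono S⊆T {x} h with view x
    ... | is-tip = contradiction h a∉embE
    ... | is-inE e = inE∈embE⁺ (S⊆T (inE∈embE⁻ h))
    ... | is-inT e t = contradiction h inT∉embE
    ⊆-split : embE (S ∪ ⁅ e ⁆) ⊆ embE S ∪ ⁅ inE e ⁆
    ⊆-split {x} h with view x
    ... | is-tip = contradiction h a∉embE
    ... | is-inT e t = contradiction h inT∉embE
    ... | is-inE e′ with ∪⁻ (inE∈embE⁻ h)
    ...   | inj₁ e′∈S = ∪⁺ˡ (inE∈embE⁺ e′∈S)
    ...   | inj₂ e′∈⁅e⁆ rewrite x∈⁅y⁆⇒x≡y e e′∈⁅e⁆ = ∪⁺ʳ (x∈⁅x⁆ _)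

-- The free cone and its flats

module FreeCone {n m} (M : Matroid n) (loopless : Loopless M)
                (Q : Matroid (coneSize n m)) (cone : IsFreeCone m M Q) where
  open IsFreeCone cone
  open ConeGround n m
  module M = MatroidProperties M
  module Q = MatroidProperties Q
  open ≤-Reasoning

  1≤r-cyclicFlat : ∀ {Z z} → IsCyclicFlat Q Z → z ∈ Z → 1 ≤ rk Q Z
  1≤r-cyclicFlat {Z} {z} cyclicFlat z∈Z with cyclicFlats Z cyclicFlat
  ... | inj₂ (F , flatF , nonempty , refl) = subst (1 ≤_) (sym (rank-q F flatF nonempty)) (s≤s z≤n)
  ... | inj₁ (Z′ , _ , refl) with view z
  ...   | is-tip = contradiction z∈Z a∉embE
  ...   | is-inT e t = contradiction z∈Z inT∉embE
  ...   | is-inE e = begin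
    1               ≡⟨ loopless e ⟨
    rk M ⁅ e ⁆      ≤⟨ M.r-mono (⁅x⁆⊆ (inE∈embE⁻ z∈Z)) ⟩
    rk M Z′         ≡⟨ rank-agree Z′ ⟨
    rk Q (embE Z′)  ∎

  cyclicFlat∌E⇒≡q : ∀ {Z z} → IsCyclicFlat Q Z → z ∈ Z → z ∉ E →
                    Σ (Subset n) λ F → IsFlat M F × Nonempty F × Z ≡ q {n} {m} F
  cyclicFlat∌E⇒≡q {Z} cyclicFlat z∈Z z∉E with cyclicFlats Z cyclicFlat
  ... | inj₁ (_ , _ , refl) = contradiction (embE⊆E z∈Z) z∉E
  ... | inj₂ F-flat-nonempty = F-flat-nonempty

  a∈cl-nonColoop : ∀ {W z} → z ∈ W → z ∉ E → rk Q (W ∖ z) ≡ rk Q W → a ∈ cl Q W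
  a∈cl-nonColoop z∈W z∉E nonColoop with Q.cyclicFlat-∋-nonColoop z∈W nonColoop
  ... | Z , cyclicFlat , z∈Z , Z⊆clW with cyclicFlat∌E⇒≡q cyclicFlat z∈Z z∉E
  ...   | _ , _ , _ , refl = Z⊆clW a∈q

  Q-loopless : Loopless Q
  Q-loopless z = ≤-antisym (Q.r-⁅⁆≤1 z) (≤∧≢⇒< z≤n 0≢r⁅z⁆)
    where
    0≢r⁅z⁆ : 0 ≢ rk Q ⁅ z ⁆
    0≢r⁅z⁆ 0≡r⁅z⁆ with Q.cyclicFlat-∋-nonColoop (x∈⁅x⁆ z)
                          (≤-antisym (Q.r-mono ∖⁻ˡ) (subst (_≤ rk Q (⁅ z ⁆ ∖ z)) 0≡r⁅z⁆ z≤n))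
    ... | Z , cyclicFlat , z∈Z , Z⊆cl⁅z⁆ = contradiction (begin
      1                  ≤⟨ 1≤r-cyclicFlat cyclicFlat z∈Z ⟩
      rk Q Z             ≤⟨ Q.r-mono Z⊆cl⁅z⁆ ⟩
      rk Q (cl Q ⁅ z ⁆)  ≡⟨ Q.r-cl _ ⟩
      rk Q ⁅ z ⁆         ≡⟨ 0≡r⁅z⁆ ⟨
      0                  ∎) λ ()

  r-q : ∀ {F} → IsFlat M F → rk Q (q {n} {m} F) ≡ suc (rk M F)
  r-q {F} flatF with nonempty? F
  ... | yes nonempty = rank-q F flatF nonempty
  ... | no empty = begin-equality
    rk Q (q F)       ≡⟨ cong (rk Q) (⊆-antisym q⊆⁅a⁆ (⁅x⁆⊆ a∈q)) ⟩
    rk Q ⁅ a ⁆       ≡⟨ Q-loopless a ⟩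
    1                ≡⟨ cong suc M.r-⊥ ⟨
    suc (rk M ⊥)     ≡⟨ cong (suc ∘ rk M) (Empty-unique empty) ⟨
    suc (rk M F)     ∎
    where
    q⊆⁅a⁆ : q F ⊆ ⁅ a ⁆
    q⊆⁅a⁆ {x} h with view x
    ... | is-tip = x∈⁅x⁆ a
    ... | is-inE e = contradiction (e , inE∈q⁻ h) empty
    ... | is-inT e t = contradiction (e , inT∈q⁻ h) empty

  rank-Q : rank Q ≡ suc (rank M)
  rank-Q = trans (cong (rk Q) (sym q-⊤)) (r-q (λ _ _ → ∈⊤))

  2≤r-pair : ∀ {x y} → x ∉ E → x ≢ y → 2 ≤ rk Q (⁅ x ⁆ ∪ ⁅ y ⁆)
  2≤r-pair {x} {y} x∉E x≢y = ≮⇒≥ r<2⇒⊥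
    where
    r<2⇒⊥ : ¬ rk Q (⁅ x ⁆ ∪ ⁅ y ⁆) < 2
    r<2⇒⊥ r<2 with Q.cyclicFlat-∋-nonColoop (∪⁺ˡ (x∈⁅x⁆ x)) (≤-antisym (Q.r-mono ∖⁻ˡ) (begin
      rk Q (⁅ x ⁆ ∪ ⁅ y ⁆)       ≤⟨ ≤-pred r<2 ⟩
      1                          ≡⟨ Q-loopless y ⟨
      rk Q ⁅ y ⁆                 ≤⟨ Q.r-mono (λ h → ∖⁺ (∪⁺ʳ h) λ z≡x → x≢y (trans (sym z≡x) (x∈⁅y⁆⇒x≡y y h))) ⟩
      rk Q ((⁅ x ⁆ ∪ ⁅ y ⁆) ∖ x) ∎))
    ... | Z , cyclicFlat , x∈Z , Z⊆cl with cyclicFlat∌E⇒≡q cyclicFlat x∈Z x∉E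
    ...   | F , flatF , (e , e∈F) , refl = <-irrefl refl (begin-strict
      2                           ≤⟨ s≤s (≤-trans (≤-reflexive (sym (loopless e))) (M.r-mono (⁅x⁆⊆ e∈F))) ⟩
      suc (rk M F)                ≡⟨ r-q flatF ⟨
      rk Q (q F)                  ≤⟨ Q.r-mono Z⊆cl ⟩
      rk Q (cl Q (⁅ x ⁆ ∪ ⁅ y ⁆)) ≡⟨ Q.r-cl _ ⟩
      rk Q (⁅ x ⁆ ∪ ⁅ y ⁆)        <⟨ r<2 ⟩
      2                           ∎)

  -- The line q (cl ⁅ e ⁆) has rank 2, and a together with any other of its points already has rank 2.
  ∈cl-a-line : ∀ e {x y} → a ≢ x → x ∈ q {n} {m} (cl M ⁅ e ⁆) → y ∈ q (cl M ⁅ e ⁆) → y ∈ cl Q (⁅ a ⁆ ∪ ⁅ x ⁆)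
  ∈cl-a-line e {x} {y} a≢x x∈line y∈line = Q.∈cl⁺ (≤-antisym (begin
    rk Q ((⁅ a ⁆ ∪ ⁅ x ⁆) ∪ ⁅ y ⁆) ≤⟨ Q.r-mono (∪-least (∪-least (⁅x⁆⊆ a∈q) (⁅x⁆⊆ x∈line)) (⁅x⁆⊆ y∈line)) ⟩
    rk Q (q (cl M ⁅ e ⁆))         ≡⟨ r-q (M.cl-flat _) ⟩
    suc (rk M (cl M ⁅ e ⁆))       ≡⟨ cong suc (trans (M.r-cl _) (loopless e)) ⟩
    2                             ≤⟨ 2≤r-pair a∉embE a≢x ⟩
    rk Q (⁅ a ⁆ ∪ ⁅ x ⁆)          ∎) (Q.r-mono ∪⁺ˡ))

  module _ {Y} (flatY : IsFlat Q Y) (a∈Y : a ∈ Y) {e : Fin n} {t : Fin m} where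

    inE∈flat⇒inT∈ : inE e ∈ Y → inT e t ∈ Y
    inE∈flat⇒inT∈ h = Q.cl⊆flat flatY (∪-least (⁅x⁆⊆ a∈Y) (⁅x⁆⊆ h))
      (∈cl-a-line e (λ ()) (inE∈q⁺ (M.⊆-cl (x∈⁅x⁆ e))) (inT∈q⁺ (M.⊆-cl (x∈⁅x⁆ e))))

    inT∈flat⇒inE∈ : inT e t ∈ Y → inE e ∈ Y
    inT∈flat⇒inE∈ h = Q.cl⊆flat flatY (∪-least (⁅x⁆⊆ a∈Y) (⁅x⁆⊆ h))
      (∈cl-a-line e (λ ()) (inT∈q⁺ (M.⊆-cl (x∈⁅x⁆ e))) (inE∈q⁺ (M.⊆-cl (x∈⁅x⁆ e))))

  flat∋a⇒≡q : ∀ {Y} → IsFlat Q Y → a ∈ Y → Σ (Subset n) λ F → IsFlat M F × Y ≡ q F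
  flat∋a⇒≡q {Y} flatY a∈Y = F , flatF , ⊆-antisym Y⊆qF qF⊆Y
    where
    F : Subset n
    F = tabulate (λ e → does (inE e ∈? Y))
    embE-F⊆Y : embE F ⊆ Y
    embE-F⊆Y {x} h with view x
    ... | is-tip = contradiction h a∉embE
    ... | is-inE e = ∈-tabulate-does⁻ (λ e → inE e ∈? Y) (inE∈embE⁻ h)
    ... | is-inT e t = contradiction h inT∉embE
    flatF : IsFlat M F
    flatF x r[F∪x]≡r[F] = ∈-tabulate-does⁺ (λ e → inE e ∈? Y) (Q.cl⊆flat flatY embE-F⊆Y (Q.∈cl⁺ (begin-equality
      rk Q (embE F ∪ ⁅ inE x ⁆) ≡⟨ cong (rk Q) (embE-∪⁅⁆ F x) ⟨
      rk Q (embE (F ∪ ⁅ x ⁆))   ≡⟨ rank-agree _ ⟩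
      rk M (F ∪ ⁅ x ⁆)          ≡⟨ r[F∪x]≡r[F] ⟩
      rk M F                    ≡⟨ rank-agree F ⟨
      rk Q (embE F)             ∎)))
    Y⊆qF : Y ⊆ q F
    Y⊆qF {x} h with view x
    ... | is-tip = a∈q
    ... | is-inE e = inE∈q⁺ (∈-tabulate-does⁺ (λ e → inE e ∈? Y) h)
    ... | is-inT e t = inT∈q⁺ (∈-tabulate-does⁺ (λ e → inE e ∈? Y) (inT∈flat⇒inE∈ flatY a∈Y h))
    qF⊆Y : q F ⊆ Y
    qF⊆Y {x} h with view x
    ... | is-tip = a∈Y
    ... | is-inE e = ∈-tabulate-does⁻ (λ e → inE e ∈? Y) (inE∈q⁻ h)
    ... | is-inT e t = inE∈flat⇒inT∈ flatY a∈Y (∈-tabulate-does⁻ (λ e → inE e ∈? Y) (inT∈q⁻ h))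

  cl-∪⁅a⁆ : ∀ A → cl Q (A ∪ ⁅ a ⁆) ≡ q (cl M (p A))
  cl-∪⁅a⁆ A with flat∋a⇒≡q (Q.cl-flat (A ∪ ⁅ a ⁆)) (Q.⊆-cl (∪⁺ʳ (x∈⁅x⁆ a)))
  ... | F , flatF , cl≡qF = trans cl≡qF (cong q (⊆-antisym F⊆G G⊆F))
    where
    G = cl M (p A)
    G⊆F : G ⊆ F
    G⊆F = M.cl⊆flat flatF (p-⊆ (subst (A ⊆_) cl≡qF (Q.⊆-cl ∘ ∪⁺ˡ)))
    F⊆G : F ⊆ G
    F⊆G = M.flat-⊇⇒⊆ (M.cl-flat _) G⊆F (≤-pred (begin
      suc (rk M F)            ≡⟨ r-q flatF ⟨
      rk Q (q F)              ≡⟨ cong (rk Q) cl≡qF ⟨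
      rk Q (cl Q (A ∪ ⁅ a ⁆)) ≡⟨ Q.r-cl _ ⟩
      rk Q (A ∪ ⁅ a ⁆)        ≤⟨ Q.r-mono (∪-least (q-mono M.⊆-cl ∘ ⊆q-p A) (⁅x⁆⊆ a∈q)) ⟩
      rk Q (q G)              ≡⟨ r-q (M.cl-flat _) ⟩
      suc (rk M G)            ∎))

  a∉cl⇒nonColoop-∩E : ∀ {W u} → a ∉ cl Q W → u ∈ W → u ∈ E →
                      rk Q (W ∖ u) ≡ rk Q W → rk Q ((W ∩ E) ∖ u) ≡ rk Q (W ∩ E)
  a∉cl⇒nonColoop-∩E {W} {u} a∉clW u∈W u∈E nonColoop =
    subst (λ V → rk Q (V ∖ u) ≡ rk Q V) ∩∁-∩∁
      (Q.nonColoop-∖coloops (W ∩ ∁ E) non-E-coloop (λ h → x∈∁p⇒x∉p (∩⁻ʳ h) u∈E) nonColoop)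
    where
    non-E-coloop : ∀ {k} → k ∈ W ∩ ∁ E → Q.IsColoop W k
    non-E-coloop k∈ = ≤∧≢⇒< (Q.r-mono ∖⁻ˡ) (a∉clW ∘ a∈cl-nonColoop (∩⁻ˡ k∈) (x∈∁p⇒x∉p (∩⁻ʳ k∈)))

  module CoveringPair {Y′ Y} (flatY′ : IsFlat Q Y′) (flatY : IsFlat Q Y) (Y′⊂Y : Y′ ⊂ Y)
               (rY≡1+rY′ : rk Q Y ≡ suc (rk Q Y′)) where
    Y′⊆Y : Y′ ⊆ Y
    Y′⊆Y = proj₁ Y′⊂Y
    open Q.Covering flatY′ flatY Y′⊆Y rY≡1+rY′

    JoinsTip : Set
    JoinsTip = Y ≡ cl Q (Y′ ∪ ⁅ a ⁆) × Y ≡ q (cl M (p Y′))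

    GrowsInE : Set
    GrowsInE = Y ∩ ∁ E ≡ Y′ ∩ ∁ E × rk Q (Y ∩ E) ≡ rk Q (Y′ ∩ E) + 1

    AddsT : Set
    AddsT = Σ (Fin n) λ e → Σ (Fin m) λ t → Y ≡ Y′ ∪ ⁅ inT e t ⁆ × e ∉ cl M (p Y′)

    a∈Y′⇒≡q : a ∈ Y′ → Σ (Subset n) λ X₁ → Σ (Subset n) λ X₂ →
                IsFlat M X₁ × IsFlat M X₂ × suc (rk M X₁) ≡ rk Q Y′ × rk M X₂ ≡ rk Q Y′ × X₁ ⊂ X₂
                × Y′ ≡ q X₁ × Y ≡ q X₂
    a∈Y′⇒≡q a∈Y′ with flat∋a⇒≡q flatY′ a∈Y′ | flat∋a⇒≡q flatY (Y′⊆Y a∈Y′)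
    ... | X₁ , flatX₁ , Y′≡qX₁ | X₂ , flatX₂ , Y≡qX₂ =
      X₁ , X₂ , flatX₁ , flatX₂ ,
      trans (sym (r-q flatX₁)) (cong (rk Q) (sym Y′≡qX₁)) ,
      suc-injective (trans (sym (r-q flatX₂)) (trans (cong (rk Q) (sym Y≡qX₂)) rY≡1+rY′)) ,
      q-⊂⁻ (subst₂ _⊂_ Y′≡qX₁ Y≡qX₂ Y′⊂Y) , Y′≡qX₁ , Y≡qX₂

    a∈Y⇒joinsTip : a ∉ Y′ → a ∈ Y → JoinsTip
    a∈Y⇒joinsTip a∉Y′ a∈Y = Y≡cl , trans Y≡cl (cl-∪⁅a⁆ Y′)
      where Y≡cl = ≡cl-F∪⁅x⁆ a∈Y a∉Y′

    newT⇒addsT : a ∉ Y → ∀ {e t} → inT e t ∈ Y → inT e t ∉ Y′ → AddsT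
    newT⇒addsT a∉Y {e} {t} z∈Y z∉Y′ = e , t , ⊆-antisym Y⊆Y′∪z (∪-least Y′⊆Y (⁅x⁆⊆ z∈Y)) , e∉cl
      where
      z = inT e t
      Y⊆Y′∪z : Y ⊆ Y′ ∪ ⁅ z ⁆
      Y⊆Y′∪z {y} y∈Y with y ∈? Y′ ∪ ⁅ z ⁆
      ... | yes y∈ = y∈
      ... | no y∉ = contradiction (Q.cl⊆flat flatY W⊆Y
                      (a∈cl-nonColoop (∪⁺ʳ (x∈⁅x⁆ z)) inT∉embE
                         (nonColoop z∈Y y∈Y z∉Y′ (y∉ ∘ ∪⁺ˡ) λ { refl → y∉ (∪⁺ʳ (x∈⁅x⁆ z)) }))) a∉Y
        where
        W⊆Y : (Y′ ∪ ⁅ y ⁆) ∪ ⁅ z ⁆ ⊆ Y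
        W⊆Y = ∪-least (∪-least Y′⊆Y (⁅x⁆⊆ y∈Y)) (⁅x⁆⊆ z∈Y)
      e∉cl : e ∉ cl M (p Y′)
      e∉cl e∈cl = a∉Y (subst (a ∈_) (sym (≡cl-F∪⁅x⁆ z∈Y z∉Y′))
        (Q.exchange flatY′ z∉Y′ (a∉Y ∘ Y′⊆Y) (subst (z ∈_) (sym (cl-∪⁅a⁆ Y′)) (inT∈q⁺ e∈cl))))

    module _ (a∉Y : a ∉ Y) (new⊆E : ∀ {z} → z ∈ Y → z ∉ Y′ → z ∈ E) where

      Y∩∁E≡Y′∩∁E : Y ∩ ∁ E ≡ Y′ ∩ ∁ E
      Y∩∁E≡Y′∩∁E = ⊆-antisym Y∩∁E⊆ (λ h → ∩⁺ (Y′⊆Y (∩⁻ˡ h)) (∩⁻ʳ h))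
        where
        Y∩∁E⊆ : Y ∩ ∁ E ⊆ Y′ ∩ ∁ E
        Y∩∁E⊆ {z} h with z ∈? Y′
        ... | yes z∈Y′ = ∩⁺ z∈Y′ (∩⁻ʳ h)
        ... | no z∉Y′ = contradiction (new⊆E (∩⁻ˡ h) z∉Y′) (x∈∁p⇒x∉p (∩⁻ʳ h))

      1+r[Y′∩E]≤r[Y∩E] : suc (rk Q (Y′ ∩ E)) ≤ rk Q (Y ∩ E)
      1+r[Y′∩E]≤r[Y∩E] = +-cancelˡ-≤ (rk Q Y′) _ _ (begin
        rk Q Y′ + suc (rk Q (Y′ ∩ E)) ≡⟨ +-suc _ _ ⟩
        suc (rk Q Y′) + rk Q (Y′ ∩ E) ≡⟨ cong (_+ rk Q (Y′ ∩ E)) rY≡1+rY′ ⟨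
        rk Q Y + rk Q (Y′ ∩ E)        ≤⟨ Q.r-submod⊆ Y′ (Y ∩ E) Y⊆Y′∪[Y∩E]
                                           (λ h → ∩⁺ (∩⁻ˡ h) (∩⁺ (Y′⊆Y (∩⁻ˡ h)) (∩⁻ʳ h))) ⟩
        rk Q Y′ + rk Q (Y ∩ E)        ∎)
        where
        Y⊆Y′∪[Y∩E] : Y ⊆ Y′ ∪ (Y ∩ E)
        Y⊆Y′∪[Y∩E] {z} z∈Y with z ∈? Y′
        ... | yes z∈Y′ = ∪⁺ˡ z∈Y′
        ... | no z∉Y′ = ∪⁺ʳ (∩⁺ z∈Y (new⊆E z∈Y z∉Y′))

      -- f is a non-coloop of W = Y′ ∪ ⁅ w ⁆ ∪ ⁅ f ⁆ ⊆ Y; as a ∉ cl Q W, the elements of W outside E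
      -- are coloops, and deleting them keeps f a non-coloop.
      Y∩E⊆cl[Y′∩E∪⁅w⁆] : ∀ {w} → w ∈ Y → w ∉ Y′ → Y ∩ E ⊆ cl Q ((Y′ ∩ E) ∪ ⁅ w ⁆)
      Y∩E⊆cl[Y′∩E∪⁅w⁆] {w} w∈Y w∉Y′ {f} f∈Y∩E with f ∈? (Y′ ∩ E) ∪ ⁅ w ⁆
      ... | yes f∈ = Q.⊆-cl f∈
      ... | no f∉ = Q.cl-mono W∩E∖f⊆ (Q.nonColoop⇒∈cl (∩⁺ (∪⁺ʳ (x∈⁅x⁆ f)) (∩⁻ʳ f∈Y∩E))
                      (a∉cl⇒nonColoop-∩E a∉clW (∪⁺ʳ (x∈⁅x⁆ f)) (∩⁻ʳ f∈Y∩E)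
                        (nonColoop (∩⁻ˡ f∈Y∩E) w∈Y f∉Y′ w∉Y′ f≢w)))
        where
        f∉Y′ : f ∉ Y′
        f∉Y′ f∈Y′ = f∉ (∪⁺ˡ (∩⁺ f∈Y′ (∩⁻ʳ f∈Y∩E)))
        f≢w : f ≢ w
        f≢w refl = f∉ (∪⁺ʳ (x∈⁅x⁆ f))
        a∉clW : a ∉ cl Q ((Y′ ∪ ⁅ w ⁆) ∪ ⁅ f ⁆)
        a∉clW = a∉Y ∘ Q.cl⊆flat flatY (∪-least (∪-least Y′⊆Y (⁅x⁆⊆ w∈Y)) (⁅x⁆⊆ (∩⁻ˡ f∈Y∩E)))
        W∩E∖f⊆ : (((Y′ ∪ ⁅ w ⁆) ∪ ⁅ f ⁆) ∩ E) ∖ f ⊆ (Y′ ∩ E) ∪ ⁅ w ⁆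
        W∩E∖f⊆ h with ∪⁻ (∩⁻ˡ (∖⁻ˡ h))
        ... | inj₂ z∈⁅f⁆ = contradiction (x∈⁅y⁆⇒x≡y f z∈⁅f⁆) (∖⁻ʳ h)
        ... | inj₁ z∈Y′∪w with ∪⁻ z∈Y′∪w
        ...   | inj₁ z∈Y′ = ∪⁺ˡ (∩⁺ z∈Y′ (∩⁻ʳ (∖⁻ˡ h)))
        ...   | inj₂ z∈⁅w⁆ = ∪⁺ʳ z∈⁅w⁆

      r[Y∩E]≤1+r[Y′∩E] : rk Q (Y ∩ E) ≤ suc (rk Q (Y′ ∩ E))
      r[Y∩E]≤1+r[Y′∩E] = let (_ , w , w∈Y , w∉Y′) = Y′⊂Y in begin
        rk Q (Y ∩ E)                    ≤⟨ Q.r-mono (Y∩E⊆cl[Y′∩E∪⁅w⁆] w∈Y w∉Y′) ⟩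
        rk Q (cl Q ((Y′ ∩ E) ∪ ⁅ w ⁆))  ≡⟨ Q.r-cl _ ⟩
        rk Q ((Y′ ∩ E) ∪ ⁅ w ⁆)         ≤⟨ Q.r-∪⁅⁆ _ w ⟩
        suc (rk Q (Y′ ∩ E))             ∎

      newE⇒growsInE : GrowsInE
      newE⇒growsInE = Y∩∁E≡Y′∩∁E , trans (≤-antisym r[Y∩E]≤1+r[Y′∩E] 1+r[Y′∩E]≤r[Y∩E]) (+-comm 1 _)

    joinsTip⇒a∈Y : JoinsTip → a ∈ Y
    joinsTip⇒a∈Y (Y≡cl , _) = subst (a ∈_) (sym Y≡cl) (Q.⊆-cl (∪⁺ʳ (x∈⁅x⁆ a)))

    exactlyOne : a ∉ Y′ → ExactlyOne JoinsTip GrowsInE AddsT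
    exactlyOne a∉Y′ = trichotomy , not-both-I-II , not-both-I-III , not-both-II-III
      where
      a∈∁E : a ∈ ∁ E
      a∈∁E = x∉p⇒x∈∁p a∉embE

      trichotomy : JoinsTip ⊎ GrowsInE ⊎ AddsT
      trichotomy with a ∈? Y
      ... | yes a∈Y = inj₁ (a∈Y⇒joinsTip a∉Y′ a∈Y)
      ... | no a∉Y with any? (λ z → (z ∈? Y) ×-dec ¬? (z ∈? Y′) ×-dec ¬? (z ∈? E))
      ...   | no no-new-non-E = inj₂ (inj₁ (newE⇒growsInE a∉Y λ {z} z∈Y z∉Y′ →
                                  decidable-stable (z ∈? E) λ z∉E → no-new-non-E (z , z∈Y , z∉Y′ , z∉E)))
      ...   | yes (z , z∈Y , z∉Y′ , z∉E) with view z
      ...     | is-tip = contradiction z∈Y a∉Y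
      ...     | is-inE e = contradiction (inE∈embE⁺ ∈⊤) z∉E
      ...     | is-inT e t = inj₂ (inj₂ (newT⇒addsT a∉Y z∈Y z∉Y′))

      not-both-I-II : ¬ (JoinsTip × GrowsInE)
      not-both-I-II (I , Y∩∁E≡ , _) =
        a∉Y′ (∩⁻ˡ (subst (a ∈_) Y∩∁E≡ (∩⁺ (joinsTip⇒a∈Y I) a∈∁E)))

      not-both-I-III : ¬ (JoinsTip × AddsT)
      not-both-I-III (I , e , t , Y≡ , _) with ∪⁻ (subst (a ∈_) Y≡ (joinsTip⇒a∈Y I))
      ... | inj₁ a∈Y′ = a∉Y′ a∈Y′
      ... | inj₂ a∈⁅z⁆ with () ← x∈⁅y⁆⇒x≡y (inT e t) a∈⁅z⁆

      not-both-II-III : ¬ (GrowsInE × AddsT)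
      not-both-II-III ((Y∩∁E≡ , _) , e , t , Y≡ , e∉cl) =
        e∉cl (M.⊆-cl (inT∈⇒∈p (∩⁻ˡ (subst (inT e t ∈_) Y∩∁E≡
          (∩⁺ (subst (inT e t ∈_) (sym Y≡) (∪⁺ʳ (x∈⁅x⁆ _))) (x∉p⇒x∈∁p inT∉embE))))))

corollary3p7 : ∀ {n : ℕ} (m k : ℕ) → 1 ≤ m →
  (M : Matroid n) → Loopless M → rank M ≡ k →
  (Q : Matroid (coneSize n m)) → IsFreeCone m M Q →
  (Y : ℕ → Subset (coneSize n m)) → IsFlag Q Y →
  (j : ℕ) → 1 ≤ j → j ≤ suc k →
  (tip {n} {m} ∈ Y (j ∸ 1) →
    Σ (Subset n) λ X₁ → Σ (Subset n) λ X₂ →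
      IsFlat M X₁ × IsFlat M X₂ × rk M X₁ ≡ j ∸ 2 × rk M X₂ ≡ j ∸ 1 × X₁ ⊂ X₂
      × Y (j ∸ 1) ≡ q {n} {m} X₁ × Y j ≡ q {n} {m} X₂)
  × (tip {n} {m} ∉ Y (j ∸ 1) →
    ExactlyOne
      (Y j ≡ cl Q (Y (j ∸ 1) ∪ ⁅ tip {n} {m} ⁆) × Y j ≡ q {n} {m} (cl M (p {n} {m} (Y (j ∸ 1)))))
      (Y j ∩ ∁ (Eset {n} {m}) ≡ Y (j ∸ 1) ∩ ∁ (Eset {n} {m})
        × rk Q (Y j ∩ Eset {n} {m}) ≡ rk Q (Y (j ∸ 1) ∩ Eset {n} {m}) + 1)
      (Σ (Fin n) λ e → Σ (Fin m) λ t →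
        Y j ≡ Y (j ∸ 1) ∪ ⁅ inT {n} {m} e t ⁆ × e ∉ cl M (p {n} {m} (Y (j ∸ 1))))
    × (tip {n} {m} ∈ Y j →
        Y j ≡ cl Q (Y (j ∸ 1) ∪ ⁅ tip {n} {m} ⁆) × Y j ≡ q {n} {m} (cl M (p {n} {m} (Y (j ∸ 1))))))
corollary3p7 m k _ M loopless refl Q cone Y (flats , chain) (suc i) _ 1+i≤1+k =
  (λ a∈Y′ → let (X₁ , X₂ , flatX₁ , flatX₂ , r[X₁]+1≡r[Y′] , r[X₂]≡r[Y′] , rest) = a∈Y′⇒≡q a∈Y′ in
    X₁ , X₂ , flatX₁ , flatX₂ , cong (_∸ 1) (trans r[X₁]+1≡r[Y′] rY′≡i) , trans r[X₂]≡r[Y′] rY′≡i , rest) ,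
  (λ a∉Y′ → exactlyOne a∉Y′ , a∈Y⇒joinsTip a∉Y′)
  where
  open FreeCone M loopless Q cone
  1+i≤rankQ : suc i ≤ rank Q
  1+i≤rankQ = subst (suc i ≤_) (sym rank-Q) 1+i≤1+k
  i≤rankQ : i ≤ rank Q
  i≤rankQ = ≤-trans (n≤1+n i) 1+i≤rankQ
  rY′≡i : rk Q (Y i) ≡ i
  rY′≡i = proj₂ (flats i i≤rankQ)
  open CoveringPair (proj₁ (flats i i≤rankQ)) (proj₁ (flats (suc i) 1+i≤rankQ)) (chain i 1+i≤rankQ)
             (trans (proj₂ (flats (suc i) 1+i≤rankQ)) (cong suc (sym rY′≡i)))
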